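{- For any function $f:\{0,1\}^n\to\{0,1\}$ and any sets $J\subseteq K\subseteq[n]$, $\mathrm{SymInf}_f(J)\le\mathrm{SymInf}_f(K)$.
   Context: $\mathcal{S}_J$ is the set of permutations of $[n]$ fixing every element outside $J$; $\pi x$ is the vector whose $\pi(i)$-th coordinate is $x_i$. $\mathrm{SymInf}_f(J)=\Pr_{x,\pi}[f(x)\ne f(\pi x)]$ with $x$ uniform in $\{0,1\}^n$ and $\pi$ uniform in $\mathcal{S}_J$, independently. -}

module Defs where

open import Data.Bool using (Bool; true; false; _∧_; _∨_; not; _xor_; if_then_else_)
open import Data.Nat using (ℕ; zero; suc)
open import Data.Integer using (+_)
open import Data.Rational using (ℚ; _/_; 0ℚ)
open import Data.Fin using (Fin; _≟_)
open import Data.Fin.Subset using (Subset)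
open import Data.List using (List; []; _∷_; [_]; map; concatMap; all; length; cartesianProduct; filterᵇ; allFin)
open import Data.Vec using (Vec; []; _∷_; lookup; tabulate)
open import Data.Product using (_×_; _,_)
open import Relation.Nullary using (does)

allVecs : {A : Set} → List A → (n : ℕ) → List (Vec A n)
allVecs xs zero = [ [] ]
allVecs xs (suc n) = concatMap (λ a → map (a ∷_) (allVecs xs n)) xs

cube : (n : ℕ) → List (Vec Bool n)
cube n = allVecs (true ∷ false ∷ []) n

-- a map [n] → [n] is given by the vector of its values
Map : ℕ → Set
Map n = Vec (Fin n) n

isInjective : {n : ℕ} → Map n → Bool
isInjective {n} σ =
  all (λ i → all (λ j → not (does (lookup σ i ≟ lookup σ j)) ∨ does (i ≟ j)) (allFin n)) (allFin n)

fixesOutside : {n : ℕ} → Subset n → Map n → Bool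
fixesOutside {n} J σ = all (λ i → lookup J i ∨ does (lookup σ i ≟ i)) (allFin n)

-- S_J : permutations of [n] (injective self-maps of a finite set) fixing every element outside J
SymGroup : {n : ℕ} → Subset n → List (Map n)
SymGroup {n} J = filterᵇ (λ σ → isInjective σ ∧ fixesOutside J σ) (allVecs (allFin n) n)

-- preimage of j under σ (first i with σ i = j; default j, never used for permutations)
preimageFrom : {n : ℕ} → Map n → Fin n → List (Fin n) → Fin n
preimageFrom σ j [] = j
preimageFrom σ j (i ∷ is) = if does (lookup σ i ≟ j) then i else preimageFrom σ j is

preimage : {n : ℕ} → Map n → Fin n → Fin n
preimage {n} σ j = preimageFrom σ j (allFin n)

-- π x : the vector whose π(i)-th coordinate is x_i
act : {n : ℕ} → Map n → Vec Bool n → Vec Bool n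
act π x = tabulate (λ j → lookup x (preimage π j))

-- uniform probability of a boolean event over a finite list (0 on the empty list)
prob : {A : Set} → List A → (A → Bool) → ℚ
prob xs P with length xs
... | zero = 0ℚ
... | suc m = (+ length (filterᵇ P xs)) / suc m

SymInf : {n : ℕ} → (Vec Bool n → Bool) → Subset n → ℚ
SymInf {n} f J = prob (cartesianProduct (cube n) (SymGroup J)) (λ { (x , π) → f x xor f (act π x) })

module Submission where

-- Let u = [f = 1], N_K = |S_K| and orbit_K(x) = #{π ∈ S_K : f(πx) = 1}.  Counting
-- pairs (x, π) by the values of f x and f(πx) gives
--     disagreements_K + 2 · coincidences_K = 2 N_K |f⁻¹(1)|,
-- where coincidences_K = ∑ₓ u(x) orbit_K(x), so it suffices to show that
-- coincidences_K / N_K decreases in K.  Since orbit_K is S_K-invariant,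
-- ∑ₓ orbit_K(x)² = N_K · coincidences_K, and since S_J ≤ S_K the S_K-average absorbs
-- the S_J-average: N_J · orbit_K(x) = ∑_{π ∈ S_K} orbit_J(πx).  Cauchy–Schwarz on the
-- latter sum yields N_J² ∑ orbit_K² ≤ N_K² ∑ orbit_J², which is the claim.

module FiniteSums where
  open import Data.Bool using (Bool; true; false)
  open import Data.Nat using (ℕ; suc; _+_; _*_; _≤_; z≤n; NonZero)
  open import Data.Nat.Properties
  open import Data.Nat.ListAction using (sum)
  open import Data.Nat.ListAction.Properties using (sum-↭; sum-++)
  open import Data.Nat.Solver using (module +-*-Solver)
  open import Data.List using (List; []; _∷_; _++_; map; length; cartesianProduct; filterᵇ)
  open import Data.List.Properties using (map-++; map-∘)
  open import Data.List.Membership.Propositional using (_∈_)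
  open import Data.List.Membership.Propositional.Properties using (∈-map⁺; ∈-map⁻)
  open import Data.List.Membership.Propositional.Properties.WithK using (unique∧set⇒bag)
  open import Data.List.Relation.Unary.Any using (here; there)
  open import Data.List.Relation.Unary.Unique.Propositional using (Unique)
  import Data.List.Relation.Unary.Unique.Propositional.Properties as Unique
  open import Data.List.Relation.Binary.BagAndSetEquality using (∼bag⇒↭)
  import Data.List.Relation.Binary.Permutation.Propositional.Properties as Perm
  open import Data.Product using (_×_; _,_)
  open import Data.Sum using (inj₁; inj₂)
  open import Function using (mk⇔)
  open import Relation.Binary.PropositionalEquality
  open +-*-Solver

  ∑ : {A : Set} → List A → (A → ℕ) → ℕ
  ∑ L f = sum (map f L)

  indicator : Bool → ℕ
  indicator true = 1
  indicator false = 0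

  ∑-cong-∈ : {A : Set} (L : List A) {f g : A → ℕ} → (∀ {a} → a ∈ L → f a ≡ g a) → ∑ L f ≡ ∑ L g
  ∑-cong-∈ [] e = refl
  ∑-cong-∈ (a ∷ L) e = cong₂ _+_ (e (here refl)) (∑-cong-∈ L (λ m → e (there m)))

  ∑-cong : {A : Set} (L : List A) {f g : A → ℕ} → (∀ a → f a ≡ g a) → ∑ L f ≡ ∑ L g
  ∑-cong L e = ∑-cong-∈ L (λ {a} _ → e a)

  ∑-mono : {A : Set} (L : List A) {f g : A → ℕ} → (∀ a → f a ≤ g a) → ∑ L f ≤ ∑ L g
  ∑-mono [] e = z≤n
  ∑-mono (a ∷ L) e = +-mono-≤ (e a) (∑-mono L e)

  ∑-+ : {A : Set} (L : List A) (f g : A → ℕ) → ∑ L (λ a → f a + g a) ≡ ∑ L f + ∑ L g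
  ∑-+ [] f g = refl
  ∑-+ (a ∷ L) f g = trans (cong (f a + g a +_) (∑-+ L f g)) (+-exchange (f a) (g a) (∑ L f) (∑ L g))
    where
    +-exchange : ∀ p q r s → (p + q) + (r + s) ≡ (p + r) + (q + s)
    +-exchange = solve 4 (λ p q r s → (p :+ q) :+ (r :+ s) := (p :+ r) :+ (q :+ s)) refl

  ∑-*ˡ : {A : Set} (L : List A) (c : ℕ) (f : A → ℕ) → ∑ L (λ a → c * f a) ≡ c * ∑ L f
  ∑-*ˡ [] c f = sym (*-zeroʳ c)
  ∑-*ˡ (a ∷ L) c f = trans (cong (c * f a +_) (∑-*ˡ L c f)) (sym (*-distribˡ-+ c (f a) (∑ L f)))

  ∑-*ʳ : {A : Set} (L : List A) (c : ℕ) (f : A → ℕ) → ∑ L (λ a → f a * c) ≡ ∑ L f * c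
  ∑-*ʳ L c f = begin
    ∑ L (λ a → f a * c) ≡⟨ ∑-cong L (λ a → *-comm (f a) c) ⟩
    ∑ L (λ a → c * f a) ≡⟨ ∑-*ˡ L c f ⟩
    c * ∑ L f          ≡⟨ *-comm c (∑ L f) ⟩
    ∑ L f * c          ∎
    where open ≡-Reasoning

  ∑-const : {A : Set} (L : List A) (c : ℕ) → ∑ L (λ _ → c) ≡ c * length L
  ∑-const [] c = sym (*-zeroʳ c)
  ∑-const (a ∷ L) c = trans (cong (c +_) (∑-const L c)) (sym (*-suc c (length L)))

  length-as-∑ : {A : Set} (L : List A) → length L ≡ ∑ L (λ _ → 1)
  length-as-∑ L = sym (trans (∑-const L 1) (*-identityˡ (length L)))

  ∈⇒length-nonZero : {A : Set} {L : List A} {a : A} → a ∈ L → NonZero (length L)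
  ∈⇒length-nonZero (here _) = _
  ∈⇒length-nonZero (there _) = _

  ∑-swap : {A B : Set} (L : List A) (M : List B) (F : A → B → ℕ) →
    ∑ L (λ a → ∑ M (F a)) ≡ ∑ M (λ b → ∑ L (λ a → F a b))
  ∑-swap [] M F = sym (trans (∑-const M 0) (*-zeroˡ (length M)))
  ∑-swap (a ∷ L) M F = trans (cong (∑ M (F a) +_) (∑-swap L M F)) (sym (∑-+ M (F a) (λ b → ∑ L (λ a → F a b))))

  ∑-map : {A B : Set} (L : List A) (g : A → B) (f : B → ℕ) → ∑ (map g L) f ≡ ∑ L (λ a → f (g a))
  ∑-map L g f = cong sum (sym (map-∘ L))

  ∑-cartesian : {A B : Set} (L : List A) (M : List B) (F : A × B → ℕ) →
    ∑ (cartesianProduct L M) F ≡ ∑ L (λ a → ∑ M (λ b → F (a , b)))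
  ∑-cartesian [] M F = refl
  ∑-cartesian (a ∷ L) M F = begin
    sum (map F (map (a ,_) M ++ cartesianProduct L M))
      ≡⟨ cong sum (map-++ F (map (a ,_) M) (cartesianProduct L M)) ⟩
    sum (map F (map (a ,_) M) ++ map F (cartesianProduct L M))
      ≡⟨ sum-++ (map F (map (a ,_) M)) (map F (cartesianProduct L M)) ⟩
    ∑ (map (a ,_) M) F + ∑ (cartesianProduct L M) F
      ≡⟨ cong₂ _+_ (∑-map M (a ,_) F) (∑-cartesian L M F) ⟩
    ∑ M (λ b → F (a , b)) + ∑ L (λ a → ∑ M (λ b → F (a , b))) ∎
    where open ≡-Reasoning

  length-filterᵇ : {A : Set} (p : A → Bool) (L : List A) → length (filterᵇ p L) ≡ ∑ L (λ a → indicator (p a))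
  length-filterᵇ p [] = refl
  length-filterᵇ p (a ∷ L) with p a
  ... | true = cong suc (length-filterᵇ p L)
  ... | false = length-filterᵇ p L

  ∑-reindex : {A : Set} (L : List A) → Unique L → (g h : A → A) →
    (∀ a → h (g a) ≡ a) → (∀ a → g (h a) ≡ a) →
    (∀ {a} → a ∈ L → g a ∈ L) → (∀ {a} → a ∈ L → h a ∈ L) →
    (F : A → ℕ) → ∑ L (λ a → F (g a)) ≡ ∑ L F
  ∑-reindex L uniq g h hg gh g∈ h∈ F = begin
    ∑ L (λ a → F (g a)) ≡⟨ sym (∑-map L g F) ⟩
    sum (map F (map g L)) ≡⟨ sum-↭ (Perm.map⁺ F (∼bag⇒↭ (unique∧set⇒bag gL-unique uniq (mk⇔ to from)))) ⟩
    ∑ L F ∎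
    where
    open ≡-Reasoning
    g-injective : ∀ {x y} → g x ≡ g y → x ≡ y
    g-injective {x} {y} e = trans (sym (hg x)) (trans (cong h e) (hg y))
    gL-unique : Unique (map g L)
    gL-unique = Unique.map⁺ g-injective uniq
    to : ∀ {x} → x ∈ map g L → x ∈ L
    to m with b , b∈L , refl ← ∈-map⁻ g m = g∈ b∈L
    from : ∀ {x} → x ∈ L → x ∈ map g L
    from {x} m = subst (_∈ map g L) (gh x) (∈-map⁺ g (h∈ m))

  -- 2xy ≤ x² + y², first when x ≤ y: writing y = x + d, the gap is d².
  two-mul≤sum-sq-ordered : ∀ {x y} → x ≤ y → 2 * (x * y) ≤ x * x + y * y
  two-mul≤sum-sq-ordered {x} x≤y with d , refl ← m≤n⇒∃[o]m+o≡n x≤y =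
    subst (2 * (x * (x + d)) ≤_) (expand x d) (m≤m+n (2 * (x * (x + d))) (d * d))
    where
    expand : ∀ x d → 2 * (x * (x + d)) + d * d ≡ x * x + (x + d) * (x + d)
    expand = solve 2 (λ x d → con 2 :* (x :* (x :+ d)) :+ d :* d := x :* x :+ (x :+ d) :* (x :+ d)) refl

  two-mul≤sum-sq : ∀ x y → 2 * (x * y) ≤ x * x + y * y
  two-mul≤sum-sq x y with ≤-total x y
  ... | inj₁ x≤y = two-mul≤sum-sq-ordered x≤y
  ... | inj₂ y≤x = subst₂ _≤_ (cong (2 *_) (*-comm y x)) (+-comm (y * y) (x * x)) (two-mul≤sum-sq-ordered y≤x)

  -- Cauchy–Schwarz: (∑ f)² ≤ |L| · ∑ f².  Twice the left side is ∑ₐ ∑_b 2 fₐ f_b,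
  -- which is termwise at most ∑ₐ ∑_b (fₐ² + f_b²) = 2 |L| ∑ f².
  cauchy-schwarz : {A : Set} (L : List A) (f : A → ℕ) → ∑ L f * ∑ L f ≤ length L * ∑ L (λ a → f a * f a)
  cauchy-schwarz L f = *-cancelˡ-≤ 2 (begin
    2 * (∑ L f * ∑ L f)                               ≡⟨ cong (2 *_) square-as-double-sum ⟩
    2 * ∑ L (λ a → ∑ L (λ b → f a * f b))             ≡⟨ sym (∑-*ˡ L 2 _) ⟩
    ∑ L (λ a → 2 * ∑ L (λ b → f a * f b))             ≡⟨ ∑-cong L (λ a → sym (∑-*ˡ L 2 _)) ⟩
    ∑ L (λ a → ∑ L (λ b → 2 * (f a * f b)))           ≤⟨ ∑-mono L (λ a → ∑-mono L (λ b → two-mul≤sum-sq (f a) (f b))) ⟩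
    ∑ L (λ a → ∑ L (λ b → f a * f a + f b * f b))     ≡⟨ ∑-cong L inner ⟩
    ∑ L (λ a → f a * f a * length L + Q)              ≡⟨ ∑-+ L _ _ ⟩
    ∑ L (λ a → f a * f a * length L) + ∑ L (λ _ → Q)  ≡⟨ cong₂ _+_ (∑-*ʳ L (length L) _) (∑-const L Q) ⟩
    Q * length L + Q * length L                       ≡⟨ solve 2 (λ q l → q :* l :+ q :* l := con 2 :* (l :* q)) refl Q (length L) ⟩
    2 * (length L * Q)                                ∎)
    where
    open ≤-Reasoning
    Q : ℕ
    Q = ∑ L (λ a → f a * f a)
    square-as-double-sum : ∑ L f * ∑ L f ≡ ∑ L (λ a → ∑ L (λ b → f a * f b))
    square-as-double-sum = trans (sym (∑-*ʳ L (∑ L f) f)) (∑-cong L (λ a → sym (∑-*ˡ L (f a) f)))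
    inner : ∀ a → ∑ L (λ b → f a * f a + f b * f b) ≡ f a * f a * length L + Q
    inner a = trans (∑-+ L (λ _ → f a * f a) (λ b → f b * f b)) (cong (_+ Q) (∑-const L (f a * f a)))


module Enumeration where
  open import Defs using (allVecs; cube; Map; isInjective; fixesOutside; SymGroup)
  open import Data.Bool using (Bool; true; false; T; not; _∨_; _∧_)
  open import Data.Bool.Properties using (T-∧)
  open import Data.Nat using (ℕ; zero; suc)
  open import Data.Fin using (Fin; _≟_)
  open import Data.Fin.Subset using (Subset; _∉_)
  open import Data.Vec using (Vec; []; _∷_; lookup)
  open import Data.Vec.Properties using (∷-injective; lookup⇒[]=; []=⇒lookup)
  open import Data.List using (List; []; _∷_; map; all; allFin)
  open import Data.List.Relation.Binary.Disjoint.Propositional using (Disjoint)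
  open import Data.List.Membership.Propositional using (_∈_)
  open import Data.List.Membership.Propositional.Properties using (∈-map⁺; ∈-map⁻; ∈-concat⁺′; ∈-allFin; ∈-filter⁺; ∈-filter⁻)
  open import Data.List.Relation.Unary.Any using (here; there)
  import Data.List.Relation.Unary.All as All
  import Data.List.Relation.Unary.All.Properties as All
  import Data.List.Relation.Unary.AllPairs as AllPairs
  import Data.List.Relation.Unary.AllPairs.Properties as AllPairs
  open import Data.List.Relation.Unary.Unique.Propositional using (Unique)
  import Data.List.Relation.Unary.Unique.Propositional.Properties as Unique
  open import Data.Product using (_,_; proj₁; proj₂)
  open import Function using (_∘_; _⇔_; mk⇔; Equivalence)
  open import Function.Definitions using (Injective)
  open import Relation.Nullary using (Dec; yes; no; does; contradiction)
  open import Relation.Nullary.Decidable using (T?)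
  open import Relation.Binary.PropositionalEquality

  allVecs-complete : {A : Set} (xs : List A) → (∀ a → a ∈ xs) → ∀ n (v : Vec A n) → v ∈ allVecs xs n
  allVecs-complete xs every zero [] = here refl
  allVecs-complete xs every (suc n) (a ∷ v) =
    ∈-concat⁺′ (∈-map⁺ (a ∷_) (allVecs-complete xs every n v)) (∈-map⁺ (λ a → map (a ∷_) (allVecs xs n)) (every a))

  allVecs-unique : {A : Set} (xs : List A) → Unique xs → ∀ n → Unique (allVecs xs n)
  allVecs-unique xs uniq zero = All.[] AllPairs.∷ AllPairs.[]
  allVecs-unique xs uniq (suc n) =
    Unique.concat⁺ (All.map⁺ (All.tabulate (λ _ → Unique.map⁺ (proj₂ ∘ ∷-injective) (allVecs-unique xs uniq n))))
                   (AllPairs.map⁺ (AllPairs.map blocks-disjoint uniq))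
    where
    blocks-disjoint : ∀ {a b} → a ≢ b → Disjoint (map (a ∷_) (allVecs xs n)) (map (b ∷_) (allVecs xs n))
    blocks-disjoint a≢b (m₁ , m₂) with _ , _ , refl ← ∈-map⁻ _ m₁ | _ , _ , e ← ∈-map⁻ _ m₂ = a≢b (proj₁ (∷-injective e))

  cube-complete : (n : ℕ) (x : Vec Bool n) → x ∈ cube n
  cube-complete n = allVecs-complete (true ∷ false ∷ []) both n
    where
    both : ∀ b → b ∈ true ∷ false ∷ []
    both true = here refl
    both false = there (here refl)

  cube-unique : (n : ℕ) → Unique (cube n)
  cube-unique = allVecs-unique _ (((λ ()) All.∷ All.[]) AllPairs.∷ (All.[] AllPairs.∷ AllPairs.[]))

  record InSym {n : ℕ} (J : Subset n) (σ : Map n) : Set where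
    field
      injective : Injective _≡_ _≡_ (lookup σ)
      fixes : ∀ i → i ∉ J → lookup σ i ≡ i

  T-all-allFin : {n : ℕ} (p : Fin n → Bool) → T (all p (allFin n)) ⇔ (∀ i → T (p i))
  T-all-allFin {n} p = mk⇔ (λ t i → All.lookup (All.all⁺ p (allFin n) t) (∈-allFin i))
                          (λ h → All.all⁻ p {allFin n} (All.tabulate (λ {i} _ → h i)))

  T-implication : {P Q : Set} (P? : Dec P) (Q? : Dec Q) → T (not (does P?) ∨ does Q?) ⇔ (P → Q)
  T-implication (yes _) (yes q) = mk⇔ (λ _ _ → q) (λ _ → _)
  T-implication (no _) (yes q) = mk⇔ (λ _ _ → q) (λ _ → _)
  T-implication (yes p) (no ¬q) = mk⇔ (λ ()) (λ h → ¬q (h p))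
  T-implication (no ¬p) (no ¬q) = mk⇔ (λ _ p → contradiction p ¬p) (λ _ → _)

  T-outside : {n : ℕ} (J : Subset n) (i : Fin n) {Q : Set} (Q? : Dec Q) → T (lookup J i ∨ does Q?) ⇔ (i ∉ J → Q)
  T-outside J i Q? with lookup J i in eq | Q?
  ... | true | _ = mk⇔ (λ _ i∉J → contradiction (lookup⇒[]= i J eq) i∉J) (λ _ → _)
  ... | false | yes q = mk⇔ (λ _ _ → q) (λ _ → _)
  ... | false | no ¬q = mk⇔ (λ ()) (λ h → ¬q (h (λ i∈J → contradiction (trans (sym ([]=⇒lookup i∈J)) eq) λ ())))

  T-isInjective : {n : ℕ} (σ : Map n) → T (isInjective σ) ⇔ Injective _≡_ _≡_ (lookup σ)
  T-isInjective σ = mk⇔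
    (λ t {i} {j} → to (T-implication (lookup σ i ≟ lookup σ j) (i ≟ j)) (to (T-all-allFin _) (to (T-all-allFin _) t i) j))
    (λ inj → from (T-all-allFin _) (λ i → from (T-all-allFin _) (λ j → from (T-implication (lookup σ i ≟ lookup σ j) (i ≟ j)) inj)))
    where open Equivalence

  T-fixesOutside : {n : ℕ} (J : Subset n) (σ : Map n) → T (fixesOutside J σ) ⇔ (∀ i → i ∉ J → lookup σ i ≡ i)
  T-fixesOutside J σ = mk⇔
    (λ t i → to (T-outside J i (lookup σ i ≟ i)) (to (T-all-allFin _) t i))
    (λ h → from (T-all-allFin _) (λ i → from (T-outside J i (lookup σ i ≟ i)) (h i)))
    where open Equivalence

  ∈SymGroup⇔InSym : {n : ℕ} (J : Subset n) {σ : Map n} → σ ∈ SymGroup J ⇔ InSym J σ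
  ∈SymGroup⇔InSym {n} J {σ} = mk⇔ to′ from′
    where
    open Equivalence
    test : Map n → Bool
    test σ = isInjective σ ∧ fixesOutside J σ
    to′ : σ ∈ SymGroup J → InSym J σ
    to′ m with _ , t ← ∈-filter⁻ (T? ∘ test) {xs = allVecs (allFin n) n} m =
      record { injective = to (T-isInjective σ) (proj₁ (to T-∧ t)) ; fixes = to (T-fixesOutside J σ) (proj₂ (to T-∧ t)) }
    from′ : InSym J σ → σ ∈ SymGroup J
    from′ s = ∈-filter⁺ (T? ∘ test) (allVecs-complete (allFin n) ∈-allFin n σ)
      (from T-∧ (from (T-isInjective σ) (InSym.injective s) , from (T-fixesOutside J σ) (InSym.fixes s)))

  SymGroup-unique : {n : ℕ} (J : Subset n) → Unique (SymGroup J)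
  SymGroup-unique {n} J = Unique.filter⁺ _ (allVecs-unique (allFin n) (Unique.allFin⁺ n) n)


module Permutations where
  open import Defs using (Map; preimageFrom; preimage; act)
  open Enumeration using (InSym)
  open import Data.Bool using (Bool)
  open import Data.Nat using (ℕ; suc)
  open import Data.Nat.Properties using (1+n≰n)
  open import Data.Fin using (Fin; _≟_; punchOut)
  open import Data.Fin.Properties using (any?; punchOut-injective; injective⇒≤)
  open import Data.Fin.Subset using (Subset; _⊆_)
  open import Data.Vec using (Vec; lookup; tabulate)
  open import Data.Vec.Properties using (lookup∘tabulate; tabulate∘lookup; tabulate-cong)
  open import Data.List using (List; _∷_; allFin)
  open import Data.List.Membership.Propositional using (_∈_)
  open import Data.List.Membership.Propositional.Properties using (∈-allFin)
  open import Data.List.Relation.Unary.Any using (here; there)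
  open import Data.Product using (∃; _,_)
  open import Function.Definitions using (Injective)
  open import Relation.Nullary using (yes; no; contradiction)
  open import Relation.Binary.PropositionalEquality

  vec-ext : {A : Set} {n : ℕ} {u v : Vec A n} → (∀ i → lookup u i ≡ lookup v i) → u ≡ v
  vec-ext {u = u} {v} h = trans (sym (tabulate∘lookup u)) (trans (tabulate-cong h) (tabulate∘lookup v))

  preimageFrom-sound : {n : ℕ} (σ : Map n) (j : Fin n) (is : List (Fin n)) {k : Fin n} → k ∈ is → lookup σ k ≡ j →
    lookup σ (preimageFrom σ j is) ≡ j
  preimageFrom-sound σ j (i ∷ is) k∈ σk≡j with lookup σ i ≟ j
  ... | yes σi≡j = σi≡j
  preimageFrom-sound σ j (i ∷ is) (here refl) σk≡j | no σi≢j = contradiction σk≡j σi≢j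
  preimageFrom-sound σ j (i ∷ is) (there k∈) σk≡j | no _ = preimageFrom-sound σ j is k∈ σk≡j

  preimage-sound : {n : ℕ} (σ : Map n) {j k : Fin n} → lookup σ k ≡ j → lookup σ (preimage σ j) ≡ j
  preimage-sound {n} σ {k = k} = preimageFrom-sound σ _ (allFin n) (∈-allFin k)

  -- Pigeonhole: an injective self-map of Fin n is surjective; otherwise punching out
  -- the missed value would inject Fin n into Fin (n - 1).
  injective⇒surjective : {n : ℕ} (σ : Map n) → Injective _≡_ _≡_ (lookup σ) → ∀ j → ∃ λ k → lookup σ k ≡ j
  injective⇒surjective {suc m} σ inj j with any? (λ k → lookup σ k ≟ j)
  ... | yes hit = hit
  ... | no miss = contradiction (injective⇒≤ squeeze-injective) 1+n≰n
    where
    avoids : ∀ k → j ≢ lookup σ k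
    avoids k e = miss (k , sym e)
    squeeze : Fin (suc m) → Fin m
    squeeze k = punchOut (avoids k)
    squeeze-injective : Injective _≡_ _≡_ squeeze
    squeeze-injective {a} {b} e = inj (punchOut-injective (avoids a) (avoids b) e)

  module _ {n : ℕ} (σ : Map n) (inj : Injective _≡_ _≡_ (lookup σ)) where
    preimage-unique : ∀ {j k} → lookup σ k ≡ j → preimage σ j ≡ k
    preimage-unique σk≡j = inj (trans (preimage-sound σ σk≡j) (sym σk≡j))

    preimage-inverseˡ : ∀ i → preimage σ (lookup σ i) ≡ i
    preimage-inverseˡ i = preimage-unique refl

    preimage-inverseʳ : ∀ j → lookup σ (preimage σ j) ≡ j
    preimage-inverseʳ j with k , σk≡j ← injective⇒surjective σ inj j = preimage-sound σ σk≡j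

  compose : {n : ℕ} → Map n → Map n → Map n
  compose σ τ = tabulate (λ i → lookup σ (lookup τ i))

  invert : {n : ℕ} → Map n → Map n
  invert σ = tabulate (preimage σ)

  identity : {n : ℕ} → Map n
  identity = tabulate (λ i → i)

  lookup-compose : {n : ℕ} (σ τ : Map n) (i : Fin n) → lookup (compose σ τ) i ≡ lookup σ (lookup τ i)
  lookup-compose σ τ = lookup∘tabulate _

  lookup-invert : {n : ℕ} (σ : Map n) (i : Fin n) → lookup (invert σ) i ≡ preimage σ i
  lookup-invert σ = lookup∘tabulate _

  lookup-act : {n : ℕ} (π : Map n) (x : Vec Bool n) (j : Fin n) → lookup (act π x) j ≡ lookup x (preimage π j)
  lookup-act π x = lookup∘tabulate _

  InSym-identity : {n : ℕ} (J : Subset n) → InSym J identity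
  InSym-identity J = record
    { injective = λ {i} {j} e → trans (sym (lookup∘tabulate _ i)) (trans e (lookup∘tabulate _ j))
    ; fixes = λ i _ → lookup∘tabulate _ i }

  compose-injective : {n : ℕ} (σ τ : Map n) → Injective _≡_ _≡_ (lookup σ) → Injective _≡_ _≡_ (lookup τ) →
    Injective _≡_ _≡_ (lookup (compose σ τ))
  compose-injective σ τ injσ injτ {i} {j} e =
    injτ (injσ (trans (sym (lookup-compose σ τ i)) (trans e (lookup-compose σ τ j))))

  InSym-compose : {n : ℕ} {J : Subset n} {σ τ : Map n} → InSym J σ → InSym J τ → InSym J (compose σ τ)
  InSym-compose {σ = σ} {τ} sσ sτ = record
    { injective = compose-injective σ τ (InSym.injective sσ) (InSym.injective sτ)
    ; fixes = λ i i∉J → trans (lookup-compose σ τ i) (trans (cong (lookup σ) (InSym.fixes sτ i i∉J)) (InSym.fixes sσ i i∉J)) }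

  invert-injective : {n : ℕ} {σ : Map n} → Injective _≡_ _≡_ (lookup σ) → Injective _≡_ _≡_ (lookup (invert σ))
  invert-injective {σ = σ} inj {i} {j} e = trans (sym (preimage-inverseʳ σ inj i))
    (trans (cong (lookup σ) (trans (sym (lookup-invert σ i)) (trans e (lookup-invert σ j)))) (preimage-inverseʳ σ inj j))

  InSym-invert : {n : ℕ} {J : Subset n} {σ : Map n} → InSym J σ → InSym J (invert σ)
  InSym-invert {σ = σ} sσ = record
    { injective = invert-injective inj
    ; fixes = λ i i∉J → trans (lookup-invert σ i) (preimage-unique σ inj (InSym.fixes sσ i i∉J)) }
    where inj = InSym.injective sσ

  InSym-mono : {n : ℕ} {J K : Subset n} → J ⊆ K → {σ : Map n} → InSym J σ → InSym K σ
  InSym-mono J⊆K sσ = record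
    { injective = InSym.injective sσ
    ; fixes = λ i i∉K → InSym.fixes sσ i (λ i∈J → i∉K (J⊆K i∈J)) }

  module _ {n : ℕ} (σ : Map n) (inj : Injective _≡_ _≡_ (lookup σ)) where
    compose-cancelˡ : ∀ ρ → compose (invert σ) (compose σ ρ) ≡ ρ
    compose-cancelˡ ρ = vec-ext λ i → begin
      lookup (compose (invert σ) (compose σ ρ)) i ≡⟨ lookup-compose (invert σ) (compose σ ρ) i ⟩
      lookup (invert σ) (lookup (compose σ ρ) i) ≡⟨ lookup-invert σ _ ⟩
      preimage σ (lookup (compose σ ρ) i)        ≡⟨ cong (preimage σ) (lookup-compose σ ρ i) ⟩
      preimage σ (lookup σ (lookup ρ i))          ≡⟨ preimage-inverseˡ σ inj _ ⟩
      lookup ρ i                                  ∎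
      where open ≡-Reasoning

    compose-cancelˡ′ : ∀ ρ → compose σ (compose (invert σ) ρ) ≡ ρ
    compose-cancelˡ′ ρ = vec-ext λ i → begin
      lookup (compose σ (compose (invert σ) ρ)) i ≡⟨ lookup-compose σ (compose (invert σ) ρ) i ⟩
      lookup σ (lookup (compose (invert σ) ρ) i)  ≡⟨ cong (lookup σ) (trans (lookup-compose (invert σ) ρ i) (lookup-invert σ _)) ⟩
      lookup σ (preimage σ (lookup ρ i))          ≡⟨ preimage-inverseʳ σ inj _ ⟩
      lookup ρ i                                  ∎
      where open ≡-Reasoning

    compose-cancelʳ : ∀ ρ → compose (compose ρ σ) (invert σ) ≡ ρ
    compose-cancelʳ ρ = vec-ext λ i → begin
      lookup (compose (compose ρ σ) (invert σ)) i ≡⟨ lookup-compose (compose ρ σ) (invert σ) i ⟩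
      lookup (compose ρ σ) (lookup (invert σ) i)  ≡⟨ lookup-compose ρ σ _ ⟩
      lookup ρ (lookup σ (lookup (invert σ) i))   ≡⟨ cong (λ k → lookup ρ (lookup σ k)) (lookup-invert σ i) ⟩
      lookup ρ (lookup σ (preimage σ i))          ≡⟨ cong (lookup ρ) (preimage-inverseʳ σ inj i) ⟩
      lookup ρ i                                  ∎
      where open ≡-Reasoning

    compose-cancelʳ′ : ∀ ρ → compose (compose ρ (invert σ)) σ ≡ ρ
    compose-cancelʳ′ ρ = vec-ext λ i → begin
      lookup (compose (compose ρ (invert σ)) σ) i ≡⟨ lookup-compose (compose ρ (invert σ)) σ i ⟩
      lookup (compose ρ (invert σ)) (lookup σ i)  ≡⟨ lookup-compose ρ (invert σ) _ ⟩
      lookup ρ (lookup (invert σ) (lookup σ i))   ≡⟨ cong (lookup ρ) (trans (lookup-invert σ _) (preimage-inverseˡ σ inj i)) ⟩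
      lookup ρ i                                  ∎
      where open ≡-Reasoning

    preimage-invert : ∀ j → preimage (invert σ) j ≡ lookup σ j
    preimage-invert j = preimage-unique (invert σ) (invert-injective inj) (trans (lookup-invert σ _) (preimage-inverseˡ σ inj j))

    act-invertˡ : ∀ x → act (invert σ) (act σ x) ≡ x
    act-invertˡ x = vec-ext λ j → begin
      lookup (act (invert σ) (act σ x)) j           ≡⟨ lookup-act (invert σ) (act σ x) j ⟩
      lookup (act σ x) (preimage (invert σ) j)      ≡⟨ lookup-act σ x _ ⟩
      lookup x (preimage σ (preimage (invert σ) j)) ≡⟨ cong (λ k → lookup x (preimage σ k)) (preimage-invert j) ⟩
      lookup x (preimage σ (lookup σ j))            ≡⟨ cong (lookup x) (preimage-inverseˡ σ inj j) ⟩
      lookup x j                                    ∎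
      where open ≡-Reasoning

    act-invertʳ : ∀ x → act σ (act (invert σ) x) ≡ x
    act-invertʳ x = vec-ext λ j → begin
      lookup (act σ (act (invert σ) x)) j           ≡⟨ lookup-act σ (act (invert σ) x) j ⟩
      lookup (act (invert σ) x) (preimage σ j)      ≡⟨ lookup-act (invert σ) x _ ⟩
      lookup x (preimage (invert σ) (preimage σ j)) ≡⟨ cong (lookup x) (preimage-invert (preimage σ j)) ⟩
      lookup x (lookup σ (preimage σ j))            ≡⟨ cong (lookup x) (preimage-inverseʳ σ inj j) ⟩
      lookup x j                                    ∎
      where open ≡-Reasoning

  -- act is a left action: (σ ∘ τ) x = σ (τ x), since σ ∘ τ maps τ⁻¹(σ⁻¹ j) to j.
  act-compose : {n : ℕ} (σ τ : Map n) → Injective _≡_ _≡_ (lookup σ) → Injective _≡_ _≡_ (lookup τ) →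
    ∀ x → act (compose σ τ) x ≡ act σ (act τ x)
  act-compose σ τ injσ injτ x = vec-ext λ j → begin
    lookup (act (compose σ τ) x) j                ≡⟨ lookup-act (compose σ τ) x j ⟩
    lookup x (preimage (compose σ τ) j)           ≡⟨ cong (lookup x) (preimage-unique (compose σ τ) (compose-injective σ τ injσ injτ) (hits j)) ⟩
    lookup x (preimage τ (preimage σ j))          ≡⟨ sym (lookup-act τ x _) ⟩
    lookup (act τ x) (preimage σ j)               ≡⟨ sym (lookup-act σ (act τ x) j) ⟩
    lookup (act σ (act τ x)) j                    ∎
    where
    open ≡-Reasoning
    hits : ∀ j → lookup (compose σ τ) (preimage τ (preimage σ j)) ≡ j
    hits j = trans (lookup-compose σ τ _) (trans (cong (lookup σ) (preimage-inverseʳ τ injτ _)) (preimage-inverseʳ σ injσ j))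


module Counting where
  open FiniteSums
  open Enumeration using (InSym; ∈SymGroup⇔InSym; SymGroup-unique; cube-complete; cube-unique)
  open Permutations
  open import Defs using (Map; SymGroup; act; cube)
  open import Data.Bool using (Bool; true; false; _xor_)
  open import Data.Nat using (ℕ; _+_; _*_; _≤_; NonZero)
  open import Data.Nat.Properties
  open import Data.Nat.Solver using (module +-*-Solver)
  open import Data.Fin.Subset using (Subset; _⊆_)
  open import Data.Vec using (Vec; replicate)
  open import Data.List using (List; length; cartesianProduct; filterᵇ)
  open import Data.List.Membership.Propositional using (_∈_)
  open import Data.List.Membership.Propositional.Properties using (∈-cartesianProduct⁺)
  open import Data.Product using (_×_; _,_)
  open import Function using (Equivalence)
  open import Relation.Binary.PropositionalEquality
  open +-*-Solver
  open Equivalence using (to; from)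

  xor-indicator : ∀ a b → indicator (a xor b) + 2 * (indicator a * indicator b) ≡ indicator a + indicator b
  xor-indicator true true = refl
  xor-indicator true false = refl
  xor-indicator false true = refl
  xor-indicator false false = refl

  ≤-from-balanced : ∀ {a b c d} → a + b ≡ c + d → d ≤ b → a ≤ c
  ≤-from-balanced {a} {b} {c} {d} e d≤b = +-cancelʳ-≤ b a c (begin
    a + b ≡⟨ e ⟩
    c + d ≤⟨ +-monoʳ-≤ c d≤b ⟩
    c + b ∎)
    where open ≤-Reasoning

  module _ {n : ℕ} (f : Vec Bool n → Bool) where
    G : Subset n → List (Map n)
    G K = SymGroup K

    N : Subset n → ℕ
    N K = length (G K)

    u : Vec Bool n → ℕ
    u x = indicator (f x)

    U : ℕ
    U = ∑ (cube n) u

    orbit : Subset n → Vec Bool n → ℕ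
    orbit K x = ∑ (G K) (λ π → u (act π x))

    disagreements : Subset n → ℕ
    disagreements K = ∑ (cube n) (λ x → ∑ (G K) (λ π → indicator (f x xor f (act π x))))

    coincidences : Subset n → ℕ
    coincidences K = ∑ (cube n) (λ x → u x * orbit K x)

    -- energy K = ∑ₓ (orbit K x)², the squared norm of the S_K-average of u (up to scaling).
    energy : Subset n → ℕ
    energy K = ∑ (cube n) (λ x → orbit K x * orbit K x)

    G-InSym : (K : Subset n) {π : Map n} → π ∈ G K → InSym K π
    G-InSym K = to (∈SymGroup⇔InSym K)

    ∑-cube-act : {K : Subset n} (π : Map n) → InSym K π → (F : Vec Bool n → ℕ) → ∑ (cube n) (λ x → F (act π x)) ≡ ∑ (cube n) F
    ∑-cube-act π sπ = ∑-reindex (cube n) (cube-unique n) (act π) (act (invert π))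
      (act-invertˡ π inj) (act-invertʳ π inj) (λ _ → cube-complete n _) (λ _ → cube-complete n _)
      where inj = InSym.injective sπ

    ∑-translateˡ : (K : Subset n) {σ : Map n} → InSym K σ → (F : Map n → ℕ) →
      ∑ (G K) (λ ρ → F (compose σ ρ)) ≡ ∑ (G K) F
    ∑-translateˡ K {σ} sσ = ∑-reindex (G K) (SymGroup-unique K) (compose σ) (compose (invert σ))
      (compose-cancelˡ σ inj) (compose-cancelˡ′ σ inj)
      (λ m → from (∈SymGroup⇔InSym K) (InSym-compose sσ (G-InSym K m)))
      (λ m → from (∈SymGroup⇔InSym K) (InSym-compose (InSym-invert sσ) (G-InSym K m)))
      where inj = InSym.injective sσ

    ∑-translateʳ : (K : Subset n) {τ : Map n} → InSym K τ → (F : Map n → ℕ) →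
      ∑ (G K) (λ ρ → F (compose ρ τ)) ≡ ∑ (G K) F
    ∑-translateʳ K {τ} sτ = ∑-reindex (G K) (SymGroup-unique K) (λ ρ → compose ρ τ) (λ ρ → compose ρ (invert τ))
      (compose-cancelʳ τ inj) (compose-cancelʳ′ τ inj)
      (λ m → from (∈SymGroup⇔InSym K) (InSym-compose (G-InSym K m) sτ))
      (λ m → from (∈SymGroup⇔InSym K) (InSym-compose (G-InSym K m) (InSym-invert sτ)))
      where inj = InSym.injective sτ

    ∑-G-const : (K : Subset n) {F : Map n → ℕ} (c : ℕ) → (∀ {π} → InSym K π → F π ≡ c) → ∑ (G K) F ≡ c * N K
    ∑-G-const K c h = trans (∑-cong-∈ (G K) (λ m → h (G-InSym K m))) (∑-const (G K) c)

    -- Each π ∈ S_K permutes the cube, so ∑ₓ orbit K x = |S_K| · U.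
    ∑-orbit : (K : Subset n) → ∑ (cube n) (orbit K) ≡ U * N K
    ∑-orbit K = begin
      ∑ (cube n) (λ x → ∑ (G K) (λ π → u (act π x))) ≡⟨ ∑-swap (cube n) (G K) _ ⟩
      ∑ (G K) (λ π → ∑ (cube n) (λ x → u (act π x))) ≡⟨ ∑-G-const K U (λ sπ → ∑-cube-act _ sπ u) ⟩
      U * N K                                         ∎
      where open ≡-Reasoning

    -- Counting pairs by whether f x and f (πx) agree: disagreements + 2 · coincidences = 2 |S_K| U.
    disagreement-identity : (K : Subset n) → disagreements K + 2 * coincidences K ≡ 2 * (N K * U)
    disagreement-identity K = begin
      disagreements K + 2 * coincidences K                 ≡⟨ cong (disagreements K +_) (sym (∑-*ˡ (cube n) 2 _)) ⟩
      disagreements K + ∑ (cube n) (λ x → 2 * (u x * orbit K x)) ≡⟨ sym (∑-+ (cube n) _ _) ⟩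
      ∑ (cube n) (λ x → mismatches x + 2 * (u x * orbit K x)) ≡⟨ ∑-cong (cube n) pointwise ⟩
      ∑ (cube n) (λ x → u x * N K + orbit K x)             ≡⟨ ∑-+ (cube n) _ _ ⟩
      ∑ (cube n) (λ x → u x * N K) + ∑ (cube n) (orbit K)  ≡⟨ cong₂ _+_ (∑-*ʳ (cube n) (N K) u) (∑-orbit K) ⟩
      U * N K + U * N K                                    ≡⟨ solve 2 (λ a b → a :* b :+ a :* b := con 2 :* (b :* a)) refl U (N K) ⟩
      2 * (N K * U)                                        ∎
      where
      open ≡-Reasoning
      mismatches : Vec Bool n → ℕ
      mismatches x = ∑ (G K) (λ π → indicator (f x xor f (act π x)))
      pointwise : ∀ x → mismatches x + 2 * (u x * orbit K x) ≡ u x * N K + orbit K x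
      pointwise x = begin
        mismatches x + 2 * (u x * orbit K x)
          ≡⟨ cong (λ t → mismatches x + 2 * t) (sym (∑-*ˡ (G K) (u x) _)) ⟩
        mismatches x + 2 * ∑ (G K) (λ π → u x * u (act π x))
          ≡⟨ cong (mismatches x +_) (sym (∑-*ˡ (G K) 2 _)) ⟩
        mismatches x + ∑ (G K) (λ π → 2 * (u x * u (act π x)))
          ≡⟨ sym (∑-+ (G K) _ _) ⟩
        ∑ (G K) (λ π → indicator (f x xor f (act π x)) + 2 * (u x * u (act π x)))
          ≡⟨ ∑-cong (G K) (λ π → xor-indicator (f x) (f (act π x))) ⟩
        ∑ (G K) (λ π → u x + u (act π x))
          ≡⟨ ∑-+ (G K) _ _ ⟩
        ∑ (G K) (λ _ → u x) + orbit K x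
          ≡⟨ cong (_+ orbit K x) (∑-const (G K) (u x)) ⟩
        u x * N K + orbit K x ∎

    -- orbit K is constant on S_K-orbits (translate the sum by τ on the right).
    orbit-invariant : (K : Subset n) {τ : Map n} → InSym K τ → ∀ y → orbit K (act τ y) ≡ orbit K y
    orbit-invariant K {τ} sτ y = begin
      ∑ (G K) (λ ρ → u (act ρ (act τ y)))   ≡⟨ ∑-cong-∈ (G K) (λ m → cong u (sym (act-compose _ τ (InSym.injective (G-InSym K m)) (InSym.injective sτ) y))) ⟩
      ∑ (G K) (λ ρ → u (act (compose ρ τ) y)) ≡⟨ ∑-translateʳ K sτ (λ ρ → u (act ρ y)) ⟩
      orbit K y                               ∎
      where open ≡-Reasoning

    -- energy K = |S_K| · coincidences K: expand one factor of orbit² and use invariance.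
    energy-identity : (K : Subset n) → energy K ≡ N K * coincidences K
    energy-identity K = begin
      ∑ (cube n) (λ x → orbit K x * orbit K x)              ≡⟨ ∑-cong (cube n) (λ x → sym (∑-*ʳ (G K) (orbit K x) _)) ⟩
      ∑ (cube n) (λ x → ∑ (G K) (λ π → u (act π x) * orbit K x)) ≡⟨ ∑-swap (cube n) (G K) _ ⟩
      ∑ (G K) (λ π → ∑ (cube n) (λ x → u (act π x) * orbit K x)) ≡⟨ ∑-G-const K (coincidences K) translated ⟩
      coincidences K * N K                                  ≡⟨ *-comm (coincidences K) (N K) ⟩
      N K * coincidences K                                  ∎
      where
      open ≡-Reasoning
      translated : ∀ {π} → InSym K π → ∑ (cube n) (λ x → u (act π x) * orbit K x) ≡ coincidences K
      translated {π} sπ = trans (∑-cong (cube n) (λ x → cong (u (act π x) *_) (sym (orbit-invariant K sπ x))))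
                                (∑-cube-act π sπ (λ x → u x * orbit K x))

    -- Averaging over S_K absorbs averaging over the subgroup S_J:
    -- |S_J| · orbit K x = ∑_{π ∈ S_K} orbit J (πx).
    subgroup-averaging : {J K : Subset n} → J ⊆ K → ∀ x → N J * orbit K x ≡ ∑ (G K) (λ π → orbit J (act π x))
    subgroup-averaging {J} {K} J⊆K x = begin
      N J * orbit K x                                          ≡⟨ *-comm (N J) (orbit K x) ⟩
      orbit K x * N J                                          ≡⟨ sym (∑-G-const J (orbit K x) translated) ⟩
      ∑ (G J) (λ σ → ∑ (G K) (λ π → u (act σ (act π x))))     ≡⟨ ∑-swap (G J) (G K) _ ⟩
      ∑ (G K) (λ π → orbit J (act π x))                        ∎
      where
      open ≡-Reasoning
      translated : ∀ {σ} → InSym J σ → ∑ (G K) (λ π → u (act σ (act π x))) ≡ orbit K x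
      translated {σ} sσ = trans
        (∑-cong-∈ (G K) (λ m → cong u (sym (act-compose σ _ (InSym.injective sσ) (InSym.injective (G-InSym K m)) x))))
        (∑-translateˡ K (InSym-mono J⊆K sσ) (λ π → u (act π x)))

    -- Energy comparison (Cauchy–Schwarz on each S_K-average): |S_J|² energy K ≤ |S_K|² energy J.
    energy-comparison : {J K : Subset n} → J ⊆ K → N J * N J * energy K ≤ N K * N K * energy J
    energy-comparison {J} {K} J⊆K = begin
      N J * N J * energy K                                          ≡⟨ sym (∑-*ˡ (cube n) (N J * N J) _) ⟩
      ∑ (cube n) (λ x → N J * N J * (orbit K x * orbit K x))        ≡⟨ ∑-cong (cube n) (λ x → trans (square-product (N J) (orbit K x)) (cong (λ t → t * t) (subgroup-averaging J⊆K x))) ⟩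
      ∑ (cube n) (λ x → averaged x * averaged x)                                  ≤⟨ ∑-mono (cube n) (λ x → cauchy-schwarz (G K) (λ π → orbit J (act π x))) ⟩
      ∑ (cube n) (λ x → N K * ∑ (G K) (λ π → orbit J (act π x) * orbit J (act π x))) ≡⟨ ∑-*ˡ (cube n) (N K) _ ⟩
      N K * ∑ (cube n) (λ x → ∑ (G K) (λ π → orbit J (act π x) * orbit J (act π x))) ≡⟨ cong (N K *_) (∑-swap (cube n) (G K) _) ⟩
      N K * ∑ (G K) (λ π → ∑ (cube n) (λ x → orbit J (act π x) * orbit J (act π x))) ≡⟨ cong (N K *_) (∑-G-const K (energy J) (λ sπ → ∑-cube-act _ sπ (λ x → orbit J x * orbit J x))) ⟩
      N K * (energy J * N K)                                        ≡⟨ solve 2 (λ a b → a :* (b :* a) := a :* a :* b) refl (N K) (energy J) ⟩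
      N K * N K * energy J                                          ∎
      where
      open ≤-Reasoning
      averaged : Vec Bool n → ℕ
      averaged x = ∑ (G K) (λ π → orbit J (act π x))
      square-product : ∀ a b → a * a * (b * b) ≡ (a * b) * (a * b)
      square-product = solve 2 (λ a b → a :* a :* (b :* b) := (a :* b) :* (a :* b)) refl

    -- The identity lies in S_K, so |S_K| > 0.
    N-nonZero : (K : Subset n) → NonZero (N K)
    N-nonZero K = ∈⇒length-nonZero (from (∈SymGroup⇔InSym K) (InSym-identity K))

    coincidence-ratio : {J K : Subset n} → J ⊆ K → N J * coincidences K ≤ N K * coincidences J
    coincidence-ratio {J} {K} J⊆K = *-cancelˡ-≤ (N J * N K) {{m*n≢0 (N J) (N K) {{N-nonZero J}} {{N-nonZero K}}}} (begin
      N J * N K * (N J * coincidences K)      ≡⟨ regroup (N J) (N K) (coincidences K) ⟩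
      N J * N J * (N K * coincidences K)      ≡⟨ cong (N J * N J *_) (sym (energy-identity K)) ⟩
      N J * N J * energy K                    ≤⟨ energy-comparison J⊆K ⟩
      N K * N K * energy J                    ≡⟨ cong (N K * N K *_) (energy-identity J) ⟩
      N K * N K * (N J * coincidences J)      ≡⟨ regroup (N K) (N J) (coincidences J) ⟨
      N K * N J * (N K * coincidences J)      ≡⟨ cong (_* (N K * coincidences J)) (*-comm (N K) (N J)) ⟩
      N J * N K * (N K * coincidences J)      ∎)
      where
      open ≤-Reasoning
      regroup : ∀ a b t → a * b * (a * t) ≡ a * a * (b * t)
      regroup = solve 3 (λ a b t → a :* b :* (a :* t) := a :* a :* (b :* t)) refl

    disagreement-ratio : {J K : Subset n} → J ⊆ K → disagreements J * N K ≤ disagreements K * N J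
    disagreement-ratio {J} {K} J⊆K = ≤-from-balanced balanced (*-monoʳ-≤ 2 (begin
      coincidences K * N J ≡⟨ *-comm (coincidences K) (N J) ⟩
      N J * coincidences K ≤⟨ coincidence-ratio J⊆K ⟩
      N K * coincidences J ≡⟨ *-comm (N K) (coincidences J) ⟩
      coincidences J * N K ∎))
      where
      open ≤-Reasoning
      scaled : ∀ M M′ → disagreements M * N M′ + 2 * (coincidences M * N M′) ≡ 2 * (N M * U) * N M′
      scaled M M′ = trans (solve 3 (λ c t m → c :* m :+ con 2 :* (t :* m) := (c :+ con 2 :* t) :* m) refl
                                   (disagreements M) (coincidences M) (N M′))
                          (cong (_* N M′) (disagreement-identity M))
      balanced : disagreements J * N K + 2 * (coincidences J * N K) ≡ disagreements K * N J + 2 * (coincidences K * N J)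
      balanced = trans (scaled J K) (trans (solve 3 (λ a b c → con 2 :* (a :* c) :* b := con 2 :* (b :* c) :* a) refl (N J) (N K) U)
                                           (sym (scaled K J)))

    pairs : Subset n → List (Vec Bool n × Map n)
    pairs K = cartesianProduct (cube n) (G K)

    disagree : Vec Bool n × Map n → Bool
    disagree (x , π) = f x xor f (act π x)

    pairs-length : (K : Subset n) → length (pairs K) ≡ N K * length (cube n)
    pairs-length K = begin
      length (pairs K)                        ≡⟨ length-as-∑ (pairs K) ⟩
      ∑ (pairs K) (λ _ → 1)                   ≡⟨ ∑-cartesian (cube n) (G K) _ ⟩
      ∑ (cube n) (λ _ → ∑ (G K) (λ _ → 1))    ≡⟨ ∑-cong (cube n) (λ _ → sym (length-as-∑ (G K))) ⟩
      ∑ (cube n) (λ _ → N K)                  ≡⟨ ∑-const (cube n) (N K) ⟩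
      N K * length (cube n)                   ∎
      where open ≡-Reasoning

    disagreeing-pairs : (K : Subset n) → length (filterᵇ disagree (pairs K)) ≡ disagreements K
    disagreeing-pairs K = trans (length-filterᵇ disagree (pairs K)) (∑-cartesian (cube n) (G K) _)

    pairs-nonempty : (K : Subset n) → (replicate n true , identity) ∈ pairs K
    pairs-nonempty K = ∈-cartesianProduct⁺ (cube-complete n _) (from (∈SymGroup⇔InSym K) (InSym-identity K))

    -- The cross-multiplied form of SymInf f J ≤ SymInf f K.
    frequency-cross : {J K : Subset n} → J ⊆ K →
      length (filterᵇ disagree (pairs J)) * length (pairs K) ≤ length (filterᵇ disagree (pairs K)) * length (pairs J)
    frequency-cross {J} {K} J⊆K = begin
      length (filterᵇ disagree (pairs J)) * length (pairs K) ≡⟨ cong₂ _*_ (disagreeing-pairs J) (pairs-length K) ⟩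
      disagreements J * (N K * length (cube n))              ≡⟨ *-assoc (disagreements J) (N K) _ ⟨
      disagreements J * N K * length (cube n)                ≤⟨ *-monoˡ-≤ (length (cube n)) (disagreement-ratio J⊆K) ⟩
      disagreements K * N J * length (cube n)                ≡⟨ *-assoc (disagreements K) (N J) _ ⟩
      disagreements K * (N J * length (cube n))              ≡⟨ cong₂ _*_ (disagreeing-pairs K) (pairs-length J) ⟨
      length (filterᵇ disagree (pairs K)) * length (pairs J) ∎
      where open ≤-Reasoning


module Frequencies where
  open import Defs using (prob)
  open import Data.Bool using (Bool)
  open import Data.Nat as ℕ using (ℕ; suc)
  open import Data.Integer as ℤ using (+_)
  import Data.Integer.Properties as ℤ
  open import Data.Rational using (_≤_; _/_)
  open import Data.Rational.Properties using (toℚᵘ-cancel-≤; toℚᵘ-fromℚᵘ)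
  open import Data.Rational.Unnormalised using (mkℚᵘ; *≤*)
  import Data.Rational.Unnormalised.Properties as ℚᵘ
  open import Data.List using (List; _∷_; length; filterᵇ)
  open import Data.List.Membership.Propositional using (_∈_)
  open import Relation.Binary.PropositionalEquality

  /-≤-cross : ∀ a b m k → a ℕ.* suc k ℕ.≤ b ℕ.* suc m → + a / suc m ≤ + b / suc k
  /-≤-cross a b m k le = toℚᵘ-cancel-≤ (ℚᵘ.≤-respˡ-≃ (ℚᵘ.≃-sym (toℚᵘ-fromℚᵘ (mkℚᵘ (+ a) m)))
    (ℚᵘ.≤-respʳ-≃ (ℚᵘ.≃-sym (toℚᵘ-fromℚᵘ (mkℚᵘ (+ b) k))) (*≤* integral)))
    where
    integral : + a ℤ.* + suc k ℤ.≤ + b ℤ.* + suc m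
    integral = subst₂ ℤ._≤_ (sym (ℤ.+◃n≡+n (a ℕ.* suc k))) (sym (ℤ.+◃n≡+n (b ℕ.* suc m))) (ℤ.+≤+ le)

  prob-≤ : {A B : Set} (xs : List A) (ys : List B) {x : A} {y : B} → x ∈ xs → y ∈ ys → {P : A → Bool} {Q : B → Bool} →
    length (filterᵇ P xs) ℕ.* length ys ℕ.≤ length (filterᵇ Q ys) ℕ.* length xs → prob xs P ≤ prob ys Q
  prob-≤ xs@(_ ∷ xs′) ys@(_ ∷ ys′) _ _ {P} {Q} = /-≤-cross (length (filterᵇ P xs)) (length (filterᵇ Q ys)) (length xs′) (length ys′)


open import Defs
open import Data.Bool using (Bool)
open import Data.Nat using (ℕ)
open import Data.Vec using (Vec)
open import Data.Fin.Subset using (Subset; _⊆_)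
open import Data.Rational using (_≤_)
open Counting using (pairs-nonempty; frequency-cross)
open Frequencies using (prob-≤)

-- SymInf f J and SymInf f K are frequencies of the same event on the samples
-- {0,1}ⁿ × S_J and {0,1}ⁿ × S_K; compare them by cross-multiplication.
lemma4 : (n : ℕ) (f : Vec Bool n → Bool) (J K : Subset n) →
    J ⊆ K → SymInf f J ≤ SymInf f K
lemma4 n f J K J⊆K = prob-≤ _ _ (pairs-nonempty f J) (pairs-nonempty f K) (frequency-cross f J⊆K)
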